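{- For every integer $n \ge 5$, the maximum $d$ for which there exists a $d$-regular distance critical graph on $n$ vertices is $\lfloor \frac{n-1}{4}\rfloor + \lfloor \frac{n}{4}\rfloor$.
   Context: All graphs are finite, simple and undirected. A graph is $d$-regular if every vertex has degree $d$. For vertices $x,y$ of a graph $G$, $d_G(x,y)$ is the length of a shortest path from $x$ to $y$ in $G$ ($\infty$ if none exists). A graph $G$ is distance critical if for every vertex $v \in V(G)$ there exist vertices $x,y \in V(G)\setminus\{v\}$ with $d_G(x,y) \neq d_{G-v}(x,y)$. -}

module Defs where

open import Data.Nat using (ℕ; zero; suc)
open import Data.Bool using (Bool; true; false)
open import Data.Fin using (Fin; punchIn)
open import Data.List using (List; length; filter; allFin)
open import Data.Maybe using (Maybe; just; nothing)
open import Data.Product using (Σ; ∃; ∃-syntax; _×_; _,_)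
open import Data.Unit using (⊤)
open import Relation.Nullary using (¬_)
open import Relation.Binary.PropositionalEquality using (_≡_; _≢_)
open import Relation.Nullary.Decidable using ()
open import Data.Bool using (_≟_)
open import Data.Nat using (_≤_)

record Graph (n : ℕ) : Set where
  field
    adj   : Fin n → Fin n → Bool
    sym   : ∀ x y → adj x y ≡ adj y x
    irrefl : ∀ x → adj x x ≡ false
open Graph public

degree : ∀ {n} → Graph n → Fin n → ℕ
degree G x = length (filter (λ y → adj G x y ≟ true) (allFin _))

Regular : ∀ {n} → ℕ → Graph n → Set
Regular d G = ∀ x → degree G x ≡ d

data Walk {n} (G : Graph n) : Fin n → Fin n → ℕ → Set where
  here : ∀ {x} → Walk G x x 0
  step : ∀ {x z y k} → adj G x z ≡ true → Walk G z y k → Walk G x y (suc k)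

-- d_G(x,y) = r, where r : Maybe ℕ and nothing encodes ∞.
IsDist : ∀ {n} → Graph n → Fin n → Fin n → Maybe ℕ → Set
IsDist G x y (just k) = Walk G x y k × (∀ j → Walk G x y j → k ≤ j)
IsDist G x y nothing  = ∀ j → ¬ Walk G x y j

-- G - v : the induced subgraph on V(G) \ {v}; its vertex i corresponds to punchIn v i in G.
deleteVertex : ∀ {m} → Graph (suc m) → Fin (suc m) → Graph m
deleteVertex G v = record
  { adj = λ i j → adj G (punchIn v i) (punchIn v j)
  ; sym = λ i j → sym G (punchIn v i) (punchIn v j)
  ; irrefl = λ i → irrefl G (punchIn v i)
  }

DistanceCritical : ∀ {n} → Graph n → Set
DistanceCritical {zero} G = ⊤
DistanceCritical {suc m} G =
  ∀ v → ∃[ i ] ∃[ j ] ∃[ a ] ∃[ b ]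
    (IsDist G (punchIn v i) (punchIn v j) a × IsDist (deleteVertex G v) i j b × a ≢ b)

{-# OPTIONS --safe #-}
module Submission where

-- A vertex v is distance critical exactly when it has a critical pair: two non-adjacent
-- neighbours p, q whose only common neighbour is v. Otherwise every walk through v can be rerouted
-- around v without becoming longer, so no distance changes when v is deleted.
--
-- In a d-regular graph on n vertices with a critical pair at v, the sets N(p), N(q), {p}, {q}
-- overlap only in v, so 2d + 1 ≤ n; as n·d is even, d = (n - 1)/2 is impossible when n ≡ 3 (mod 4),
-- and both facts together give d ≤ ⌊(n - 1)/4⌋ + ⌊n/4⌋.
--
-- The bound is attained for n = 4k + r, r ∈ {1, 2, 3}, by the circulant graph joining vertices at
-- cyclic distance at most k: it is vertex-transitive, and k, n - k is a critical pair at 0 because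
-- n > 4k. For n = 4k, k ≥ 2, take blocks A, B, C, D of size k, each a clique, with A–C and B–D perfect
-- matchings, B–C the complement of a perfect matching, and A–D the complement of the matching
-- shifted by a fixed-point-free permutation σ; every vertex has degree 2k - 1 and a critical pair
-- whose two members are also joined by a path of length 3 avoiding it.

open import Data.Bool as Bool using (Bool; true; false; not; _∨_)
open import Data.Bool.Properties using (∨-comm; ∨-zeroʳ; ¬-not)
open import Data.Empty using (⊥; ⊥-elim)
open import Data.Fin as Fin using (Fin; zero; suc; toℕ; fromℕ; fromℕ<; inject₁; punchIn; punchOut)
import Data.Fin.Properties as Fin
open import Data.Fin.Permutation as Perm using (Permutation′; _⟨$⟩ʳ_; _⟨$⟩ˡ_; _∘ₚ_)
open import Data.Fin.Relation.Unary.Top using (view; ‵fromℕ; ‵inject₁)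
open import Data.List using (length; filter; tabulate)
open import Data.Maybe using (just; nothing)
open import Data.Nat
open import Data.Nat.Properties
open import Data.Nat.Divisibility
  using (_∣_; divides-refl; _∣0; m∣m*n; ∣m∣n⇒∣m+n; ∣m+n∣m⇒∣n; ∣1⇒≡1)
open import Data.Nat.DivMod using (_divMod_; result; +-distrib-/-∣ʳ; m<n⇒m/n≡0; m*n/n≡m)
open import Data.Nat.Primality using (prime[2]; euclidsLemma)
open import Data.Nat.Solver using (module +-*-Solver)
open import Data.Product using (∃; ∃-syntax; _×_; _,_; proj₁; proj₂)
open import Data.Sum as Sum using (_⊎_; inj₁; inj₂)
open import Function using (_∘_; _⇔_; mk⇔)
open import Function.Bundles using (Injection)
open import Function.Properties.Inverse using (↔⇒↣)
open import Relation.Binary.PropositionalEquality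
open import Relation.Nullary using (¬_; Dec; yes; no; does; contradiction; ¬¬-map)
open import Relation.Nullary.Decidable
  using (_×-dec_; ¬?; decidable-stable; dec-true; dec-false; does-⇔)
open import Relation.Unary using (Decidable)
open import Defs renaming (sym to adj-sym)

open import Algebra.Properties.CommutativeMonoid.Sum +-0-commutativeMonoid
  using (sum-syntax; sum-replicate-zero; sum-cong-≗; ∑-distrib-+; ∑-comm; ∑-permute)

-- Finite sums

𝟙 : Bool → ℕ
𝟙 true  = 1
𝟙 false = 0

∑-const : ∀ n c → ∑[ i < n ] c ≡ n * c
∑-const zero    c = refl
∑-const (suc n) c = cong (c +_) (∑-const n c)

∑-mono-≤ : ∀ {n} {f g : Fin n → ℕ} → (∀ i → f i ≤ g i) → ∑[ i < n ] f i ≤ ∑[ i < n ] g i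
∑-mono-≤ {zero}  f≤g = z≤n
∑-mono-≤ {suc n} f≤g = +-mono-≤ (f≤g zero) (∑-mono-≤ (f≤g ∘ suc))

∑-↑ : ∀ {m n} (f : Fin (m + n) → ℕ) →
  ∑[ x < m + n ] f x ≡ ∑[ i < m ] f (i Fin.↑ˡ n) + ∑[ j < n ] f (m Fin.↑ʳ j)
∑-↑ {zero}  f = refl
∑-↑ {suc m} {n} f = trans (cong (f zero +_) (∑-↑ {m} {n} (f ∘ suc))) (sym (+-assoc (f zero) _ _))

∑-combine : ∀ {m n} (f : Fin (m * n) → ℕ) →
  ∑[ x < m * n ] f x ≡ ∑[ i < m ] ∑[ j < n ] f (Fin.combine i j)
∑-combine {zero}      f = refl
∑-combine {suc m} {n} f =
  trans (∑-↑ {n} {m * n} f) (cong (∑[ j < n ] f (j Fin.↑ˡ m * n) +_) (∑-combine {m} {n} (f ∘ (n Fin.↑ʳ_))))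

∑-𝟙-≟ : ∀ {n} (a : Fin n) → ∑[ i < n ] 𝟙 (does (a Fin.≟ i)) ≡ 1
∑-𝟙-≟ {suc n} zero    = cong suc (sum-replicate-zero n)
∑-𝟙-≟ {suc n} (suc a) = ∑-𝟙-≟ a

∑-𝟙-≢ : ∀ {n} (a : Fin (suc n)) → ∑[ i < suc n ] 𝟙 (not (does (a Fin.≟ i))) ≡ n
∑-𝟙-≢ {n}     zero    = trans (∑-const n 1) (*-identityʳ n)
∑-𝟙-≢ {suc n} (suc a) = cong suc (∑-𝟙-≢ a)

𝟙-∨-disjoint : ∀ {A B : Set} → (A → ¬ B) → (a? : Dec A) (b? : Dec B) →
  𝟙 (does a? ∨ does b?) ≡ 𝟙 (does a?) + 𝟙 (does b?)
𝟙-∨-disjoint A⇒¬B (yes a) (yes b) = contradiction b (A⇒¬B a)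
𝟙-∨-disjoint _     (yes _) (no _) = refl
𝟙-∨-disjoint _     (no _)  _      = refl

does⇒ : ∀ {A : Set} (a? : Dec A) → does a? ≡ true → A
does⇒ (yes a) _  = a
does⇒ (no _)  ()

does-∨⇒⊎ : ∀ {A B : Set} (a? : Dec A) (b? : Dec B) → does a? ∨ does b? ≡ true → A ⊎ B
does-∨⇒⊎ (yes a) _       _  = inj₁ a
does-∨⇒⊎ (no _)  (yes b) _  = inj₂ b
does-∨⇒⊎ (no _)  (no _)  ()

a<k⇔m≤c+k : ∀ {a c k m} → suc (a + c) ≡ m → a < k ⇔ m ≤ c + k
a<k⇔m≤c+k {a} {c} {k} refl = mk⇔
  (λ a<k → subst (suc (a + c) ≤_) (+-comm k c) (+-monoˡ-≤ c a<k))
  (λ m≤c+k → +-cancelʳ-≤ c (suc a) k (subst (suc (a + c) ≤_) (+-comm c k) m≤c+k))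

∑-𝟙-i<k : ∀ {n k} → k ≤ n → ∑[ i < n ] 𝟙 (does (toℕ i <? k)) ≡ k
∑-𝟙-i<k {n}     {zero}  _         = sum-replicate-zero n
∑-𝟙-i<k {suc n} {suc k} (s≤s k≤n) = cong suc (∑-𝟙-i<k k≤n)

∑-𝟙-n≤i+k : ∀ {n k} → k ≤ n → ∑[ i < n ] 𝟙 (does (n ≤? toℕ i + k)) ≡ k
∑-𝟙-n≤i+k {n} {k} k≤n = begin
  ∑[ i < n ] 𝟙 (does (n ≤? toℕ i + k))
    ≡⟨ ∑-permute (λ i → 𝟙 (does (n ≤? toℕ i + k))) (Perm.reverse {n}) ⟩
  ∑[ i < n ] 𝟙 (does (n ≤? toℕ (Fin.opposite i) + k))
    ≡⟨ sum-cong-≗ (λ i → cong 𝟙 (does-⇔ (a<k⇔m≤c+k (mirror i)) (toℕ i <? k) (n ≤? toℕ (Fin.opposite i) + k))) ⟨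
  ∑[ i < n ] 𝟙 (does (toℕ i <? k))
    ≡⟨ ∑-𝟙-i<k k≤n ⟩
  k ∎
  where
  open ≡-Reasoning
  mirror : ∀ i → suc (toℕ i + toℕ (Fin.opposite i)) ≡ n
  mirror i = trans (cong (λ o → suc (toℕ i + o)) (Fin.opposite-prop i)) (m+[n∸m]≡n (Fin.toℕ<n i))

-- Degrees and walks

Edge : ∀ {n} → Graph n → Fin n → Fin n → Set
Edge G x y = adj G x y ≡ true

edge⇒≢ : ∀ {n} (G : Graph n) {x y} → Edge G x y → x ≢ y
edge⇒≢ G {x} x~x refl = contradiction (trans (sym x~x) (irrefl G x)) λ ()

length-filter-tabulate : ∀ {A : Set} {n} (f : Fin n → A) (b : A → Bool) →
  length (filter (λ y → b y Bool.≟ true) (tabulate f)) ≡ ∑[ i < n ] 𝟙 (b (f i))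
length-filter-tabulate {n = zero}  f b = refl
length-filter-tabulate {n = suc n} f b with b (f zero)
... | true  = cong suc (length-filter-tabulate (f ∘ suc) b)
... | false = length-filter-tabulate (f ∘ suc) b

degree≡∑ : ∀ {n} (G : Graph n) x → degree G x ≡ ∑[ y < n ] 𝟙 (adj G x y)
degree≡∑ G x = length-filter-tabulate (λ y → y) (adj G x)

∑∑-symmetric-even : ∀ {n} (r : Fin n → Fin n → Bool) →
  (∀ x y → r x y ≡ r y x) → (∀ x → r x x ≡ false) → 2 ∣ (∑[ x < n ] ∑[ y < n ] 𝟙 (r x y))
∑∑-symmetric-even {zero}  r r-sym r-irrefl = 2 ∣0
∑∑-symmetric-even {suc n} r r-sym r-irrefl = subst (2 ∣_) (sym total) (∣m∣n⇒∣m+n (m∣m*n row)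
  (∑∑-symmetric-even (λ x y → r (suc x) (suc y)) (λ x y → r-sym (suc x) (suc y)) (r-irrefl ∘ suc)))
  where
  row  = ∑[ y < n ] 𝟙 (r zero (suc y))
  rest = ∑[ x < n ] ∑[ y < n ] 𝟙 (r (suc x) (suc y))
  open ≡-Reasoning
  total : ∑[ x < suc n ] ∑[ y < suc n ] 𝟙 (r x y) ≡ 2 * row + rest
  total = begin
    𝟙 (r zero zero) + row + ∑[ x < n ] (𝟙 (r (suc x) zero) + ∑[ y < n ] 𝟙 (r (suc x) (suc y)))
      ≡⟨ cong₂ (λ b s → 𝟙 b + row + s) (r-irrefl zero)
               (∑-distrib-+ (λ x → 𝟙 (r (suc x) zero)) (λ x → ∑[ y < n ] 𝟙 (r (suc x) (suc y)))) ⟩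
    row + (∑[ x < n ] 𝟙 (r (suc x) zero) + rest)
      ≡⟨ cong (λ s → row + (s + rest)) (sum-cong-≗ (λ x → cong 𝟙 (r-sym (suc x) zero))) ⟩
    row + (row + rest)
      ≡⟨ cong (λ t → row + (t + rest)) (+-identityʳ row) ⟨
    row + ((row + 0) + rest)
      ≡⟨ +-assoc row (row + 0) rest ⟨
    2 * row + rest ∎

handshake : ∀ {n d} (G : Graph n) → Regular d G → 2 ∣ n * d
handshake {n} {d} G regular = subst (2 ∣_) degree-sum (∑∑-symmetric-even (adj G) (adj-sym G) (irrefl G))
  where
  degree-sum : ∑[ x < n ] ∑[ y < n ] 𝟙 (adj G x y) ≡ n * d
  degree-sum = trans (sum-cong-≗ (λ x → trans (sym (degree≡∑ G x)) (regular x))) (∑-const n d)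

walk₀⇒≡ : ∀ {n} {G : Graph n} {x y} → Walk G x y 0 → x ≡ y
walk₀⇒≡ here = refl

walk₁⇒edge : ∀ {n} {G : Graph n} {x y} → Walk G x y 1 → Edge G x y
walk₁⇒edge (step x~y here) = x~y

walk₂⇒midpoint : ∀ {n} {G : Graph n} {x y} → Walk G x y 2 → ∃[ u ] Edge G x u × Edge G u y
walk₂⇒midpoint (step {z = u} x~u (step u~y here)) = u , x~u , u~y

_++ʷ_ : ∀ {n} {G : Graph n} {x y z a b} → Walk G x y a → Walk G y z b → Walk G x z (a + b)
here       ++ʷ w′ = w′
step x~z w ++ʷ w′ = step x~z (w ++ʷ w′)

walk? : ∀ {n} (G : Graph n) x y L → Dec (Walk G x y L)
walk? G x y zero with x Fin.≟ y
... | yes refl = yes here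
... | no x≢y   = no (x≢y ∘ walk₀⇒≡)
walk? G x y (suc L) with Fin.any? (λ z → (adj G x z Bool.≟ true) ×-dec walk? G z y L)
... | yes (z , x~z , w) = yes (step x~z w)
... | no ∄z             = no λ { (step {z = z} x~z w) → ∄z (z , x~z , w) }

least : ∀ {P : ℕ → Set} → Decidable P → ∀ {n} → P n → ∃[ m ] P m × (∀ j → P j → m ≤ j)
least P? pn with P? 0
... | yes p₀ = 0 , p₀ , λ _ _ → z≤n
least P? {zero}  pn | no ¬p₀ = contradiction pn ¬p₀
least P? {suc n} pn | no ¬p₀ with least (P? ∘ suc) pn
... | m , pm , m-least = suc m , pm , λ where
  zero    p₀ → contradiction p₀ ¬p₀
  (suc j) pj → s≤s (m-least j pj)

walk⇒isDist : ∀ {n} {G : Graph n} {x y L} → Walk G x y L → ∃[ k ] IsDist G x y (just k)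
walk⇒isDist {G = G} {x} {y} w = least (walk? G x y) w

ascending-walk : ∀ {n} (G : Graph n) → (∀ a b → toℕ b ≡ suc (toℕ a) → Edge G a b) →
  ∀ d {a b} → toℕ a + d ≡ toℕ b → Walk G a b d
ascending-walk G consecutive zero {a} a+0≡b =
  subst (λ b → Walk G a b 0) (Fin.toℕ-injective (trans (sym (+-identityʳ (toℕ a))) a+0≡b)) here
ascending-walk {n} G consecutive (suc d) {a} {b} a+[d+1]≡b =
  step (consecutive a a′ (Fin.toℕ-fromℕ< a+1<n))
       (ascending-walk G consecutive d (trans (cong (_+ d) (Fin.toℕ-fromℕ< a+1<n)) a+1+d≡b))
  where
  a+1+d≡b : suc (toℕ a) + d ≡ toℕ b
  a+1+d≡b = trans (sym (+-suc (toℕ a) d)) a+[d+1]≡b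
  a+1<n : suc (toℕ a) < n
  a+1<n = ≤-<-trans (≤-trans (m≤m+n (suc (toℕ a)) d) (≤-reflexive a+1+d≡b)) (Fin.toℕ<n b)
  a′ = fromℕ< a+1<n

module _ {m} (G : Graph (suc m)) (v : Fin (suc m)) where

  walk-deleteVertex : ∀ {i j L} → Walk (deleteVertex G v) i j L → Walk G (punchIn v i) (punchIn v j) L
  walk-deleteVertex here         = here
  walk-deleteVertex (step i~k w) = step i~k (walk-deleteVertex w)

  edge-punchOut : ∀ {x y} (v≢x : v ≢ x) (v≢y : v ≢ y) → Edge G x y →
    Edge (deleteVertex G v) (punchOut v≢x) (punchOut v≢y)
  edge-punchOut v≢x v≢y =
    subst₂ (Edge G) (sym (Fin.punchIn-punchOut v≢x)) (sym (Fin.punchIn-punchOut v≢y))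

-- Critical pairs

-- DistanceCritical G unfolds to ∀ v → DistanceCriticalAt G v.
DistanceCriticalAt : ∀ {m} → Graph (suc m) → Fin (suc m) → Set
DistanceCriticalAt G v = ∃[ i ] ∃[ j ] ∃[ a ] ∃[ b ]
  (IsDist G (punchIn v i) (punchIn v j) a × IsDist (deleteVertex G v) i j b × a ≢ b)

record CriticalPair {n} (G : Graph n) (v : Fin n) : Set where
  field
    p q             : Fin n
    v~p             : Edge G v p
    v~q             : Edge G v q
    p≢q             : p ≢ q
    p≁q             : adj G p q ≡ false
    midpoint-unique : ∀ u → Edge G p u → Edge G u q → u ≡ v

module _ {m} {G : Graph (suc m)} {v : Fin (suc m)} (c : CriticalPair G v) where
  open CriticalPair c

  criticalPair-dist₂ : IsDist G p q (just 2)
  criticalPair-dist₂ = step (trans (adj-sym G p v) v~p) (step v~q here) , shortest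
    where
    shortest : ∀ l → Walk G p q l → 2 ≤ l
    shortest 0             w = contradiction (walk₀⇒≡ w) p≢q
    shortest 1             w = contradiction (trans (sym (walk₁⇒edge w)) p≁q) λ ()
    shortest (suc (suc l)) _ = s≤s (s≤s z≤n)

  criticalPair⇒distanceCriticalAt : ∀ {i j L} → punchIn v i ≡ p → punchIn v j ≡ q →
    Walk (deleteVertex G v) i j L → DistanceCriticalAt G v
  criticalPair⇒distanceCriticalAt {i} {j} i↦p j↦q w with walk⇒isDist w
  ... | b , dist-b@(walk-b , _) = i , j , just 2 , just b , dist-2 , dist-b , 2≢b
    where
    dist-2 : IsDist G (punchIn v i) (punchIn v j) (just 2)
    dist-2 = subst₂ (λ x y → IsDist G x y (just 2)) (sym i↦p) (sym j↦q) criticalPair-dist₂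
    2≢b : just 2 ≢ just b
    2≢b refl with walk₂⇒midpoint walk-b
    ... | u , i~u , u~j = Fin.punchInᵢ≢i v u
      (midpoint-unique (punchIn v u) (subst (λ x → Edge G x (punchIn v u)) i↦p i~u)
                                     (subst (Edge G (punchIn v u)) j↦q u~j))

  criticalPair⇒distanceCriticalAt₃ : ∀ {x y} → v ≢ x → v ≢ y →
    Edge G p x → Edge G x y → Edge G y q → DistanceCriticalAt G v
  criticalPair⇒distanceCriticalAt₃ v≢x v≢y p~x x~y y~q =
    criticalPair⇒distanceCriticalAt (Fin.punchIn-punchOut v≢p) (Fin.punchIn-punchOut v≢q)
      (step (edge-punchOut G v v≢p v≢x p~x)
      (step (edge-punchOut G v v≢x v≢y x~y)
      (step (edge-punchOut G v v≢y v≢q y~q) here)))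
    where
    v≢p = edge⇒≢ G v~p
    v≢q = edge⇒≢ G v~q

Bypassed : ∀ {n} → Graph n → Fin n → Set
Bypassed G v = ∀ {p q} → Edge G v p → Edge G v q → p ≢ q →
  Edge G p q ⊎ ∃[ u ] u ≢ v × Edge G p u × Edge G u q

¬criticalPair⇒bypassed : ∀ {n} {G : Graph n} {v} → ¬ CriticalPair G v → Bypassed G v
¬criticalPair⇒bypassed {G = G} {v} ¬c {p} {q} v~p v~q p≢q with adj G p q in p?q
... | true  = inj₁ refl
... | false
  with Fin.any? (λ u → ¬? (u Fin.≟ v) ×-dec (adj G p u Bool.≟ true) ×-dec (adj G u q Bool.≟ true))
...   | yes (u , u≢v , p~u , u~q) = inj₂ (u , u≢v , p~u , u~q)
...   | no ∄u = contradiction c ¬c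
  where
  c : CriticalPair G v
  c = record
    { p = p ; q = q ; v~p = v~p ; v~q = v~q ; p≢q = p≢q ; p≁q = p?q
    ; midpoint-unique = λ u p~u u~q → decidable-stable (u Fin.≟ v) (λ u≢v → ∄u (u , u≢v , p~u , u~q))
    }

module _ {m} {G : Graph (suc m)} {v : Fin (suc m)} (bypassed : Bypassed G v) where
  private
    H = deleteVertex G v

  detour : ∀ {x z} (v≢x : v ≢ x) (v≢z : v ≢ z) → Edge G x v → Edge G v z →
    ∃[ l ] l ≤ 2 × Walk H (punchOut v≢x) (punchOut v≢z) l
  detour {x} {z} v≢x v≢z x~v v~z with x Fin.≟ z
  ... | yes refl = 0 , z≤n , subst (λ t → Walk H _ t 0) (Fin.punchOut-cong v refl) here
  ... | no x≢z with bypassed (trans (adj-sym G v x) x~v) v~z x≢z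
  ...   | inj₁ x~z = 1 , s≤s z≤n , step (edge-punchOut G v v≢x v≢z x~z) here
  ...   | inj₂ (u , u≢v , x~u , u~z) =
    2 , ≤-refl , step (edge-punchOut G v v≢x v≢u x~u) (step (edge-punchOut G v v≢u v≢z u~z) here)
    where
    v≢u = u≢v ∘ sym

  -- Every visit x → v → z is replaced by a detour from x to z of length at most 2.
  reroute : ∀ {x y L} (v≢x : v ≢ x) (v≢y : v ≢ y) → Walk G x y L →
    ∃[ L′ ] L′ ≤ L × Walk H (punchOut v≢x) (punchOut v≢y) L′
  reroute v≢x v≢y here = 0 , z≤n , subst (λ t → Walk H _ t 0) (Fin.punchOut-cong v refl) here
  reroute v≢x v≢y (step {z = z} x~z w) with v Fin.≟ z
  ... | no v≢z with reroute v≢z v≢y w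
  ...   | L′ , L′≤L , w′ = suc L′ , s≤s L′≤L , step (edge-punchOut G v v≢x v≢z x~z) w′
  reroute v≢x v≢y (step x~v here) | yes refl = contradiction refl v≢y
  reroute v≢x v≢y (step x~v (step v~z w)) | yes refl
    with detour v≢x (edge⇒≢ G v~z) x~v v~z | reroute (edge⇒≢ G v~z) v≢y w
  ... | l , l≤2 , w₁ | L′ , L′≤L , w₂ = l + L′ , +-mono-≤ l≤2 L′≤L , w₁ ++ʷ w₂

  bypassed⇒¬distanceCriticalAt : ¬ DistanceCriticalAt G v
  bypassed⇒¬distanceCriticalAt (i , j , a , b , dist-a , dist-b , a≢b) =
    a≢b (same-distance a b dist-a dist-b)
    where
    shorten : ∀ {L} → Walk G (punchIn v i) (punchIn v j) L → ∃[ L′ ] L′ ≤ L × Walk H i j L′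
    shorten w with reroute (Fin.punchInᵢ≢i v i ∘ sym) (Fin.punchInᵢ≢i v j ∘ sym) w
    ... | L′ , L′≤L , w′ =
      L′ , L′≤L , subst₂ (λ s t → Walk H s t L′) (Fin.punchOut-punchIn v) (Fin.punchOut-punchIn v) w′
    same-distance : ∀ a b → IsDist G (punchIn v i) (punchIn v j) a → IsDist H i j b → a ≡ b
    same-distance (just k) (just l) (walk-k , k-least) (walk-l , l-least) with shorten walk-k
    ... | L′ , L′≤k , w′ =
      cong just (≤-antisym (k-least l (walk-deleteVertex G v walk-l)) (≤-trans (l-least L′ w′) L′≤k))
    same-distance (just k) nothing (walk-k , _) ∄l with shorten walk-k
    ... | L′ , _ , w′ = contradiction w′ (∄l L′)
    same-distance nothing (just l) ∄k (walk-l , _) = contradiction (walk-deleteVertex G v walk-l) (∄k l)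
    same-distance nothing nothing _ _ = refl

distanceCriticalAt⇒¬¬criticalPair : ∀ {m} {G : Graph (suc m)} {v} →
  DistanceCriticalAt G v → ¬ ¬ CriticalPair G v
distanceCriticalAt⇒¬¬criticalPair dc ¬c = bypassed⇒¬distanceCriticalAt (¬criticalPair⇒bypassed ¬c) dc

-- The upper bound

module _ {n} {G : Graph n} {v} (c : CriticalPair G v) where
  open CriticalPair c

  private
    _≟ᵇ_ : Fin n → Fin n → Bool
    x ≟ᵇ y = does (x Fin.≟ y)

  -- Apart from v ∈ N(p) ∩ N(q), the sets N(p), N(q), {p} and {q} are pairwise disjoint.
  at-most-one-role : ∀ y → y ≢ v → 𝟙 (adj G p y) + 𝟙 (adj G q y) + (𝟙 (p ≟ᵇ y) + 𝟙 (q ≟ᵇ y)) ≤ 1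
  at-most-one-role y y≢v with p Fin.≟ y | q Fin.≟ y
  ... | yes refl | yes refl = contradiction refl p≢q
  ... | yes refl | no _ rewrite irrefl G p | trans (adj-sym G q p) p≁q = ≤-refl
  ... | no _     | yes refl rewrite p≁q | irrefl G q = ≤-refl
  ... | no _     | no _ with adj G p y in p~y | adj G q y in q~y
  ...   | true  | true  = contradiction (midpoint-unique y p~y (trans (adj-sym G y q) q~y)) y≢v
  ...   | true  | false = ≤-refl
  ...   | false | true  = ≤-refl
  ...   | false | false = z≤n

  roles-bound : ∀ y → 𝟙 (adj G p y) + 𝟙 (adj G q y) + (𝟙 (p ≟ᵇ y) + 𝟙 (q ≟ᵇ y)) ≤ 1 + 𝟙 (v ≟ᵇ y)
  roles-bound y with v Fin.≟ y
  ... | no v≢y   = at-most-one-role y (v≢y ∘ sym)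
  ... | yes refl rewrite trans (adj-sym G p y) v~p | trans (adj-sym G q y) v~q
                       | dec-false (p Fin.≟ y) (edge⇒≢ G v~p ∘ sym)
                       | dec-false (q Fin.≟ y) (edge⇒≢ G v~q ∘ sym) = ≤-refl

  criticalPair⇒2d<n : ∀ {d} → Regular d G → 2 * d < n
  criticalPair⇒2d<n {d} regular =
    +-cancelʳ-≤ 1 (suc (2 * d)) n (subst₂ _≤_ roles-sum slots-sum (∑-mono-≤ roles-bound))
    where
    open ≡-Reasoning
    N E : Fin n → Fin n → ℕ
    N x y = 𝟙 (adj G x y)
    E x y = 𝟙 (x ≟ᵇ y)
    roles-sum : ∑[ y < n ] (N p y + N q y + (E p y + E q y)) ≡ suc (2 * d) + 1
    roles-sum = begin
      ∑[ y < n ] (N p y + N q y + (E p y + E q y))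
        ≡⟨ ∑-distrib-+ (λ y → N p y + N q y) (λ y → E p y + E q y) ⟩
      ∑[ y < n ] (N p y + N q y) + ∑[ y < n ] (E p y + E q y)
        ≡⟨ cong₂ _+_ (∑-distrib-+ (N p) (N q)) (∑-distrib-+ (E p) (E q)) ⟩
      (∑[ y < n ] N p y + ∑[ y < n ] N q y) + (∑[ y < n ] E p y + ∑[ y < n ] E q y)
        ≡⟨ cong₂ _+_ (cong₂ _+_ (N-sum p) (N-sum q)) (cong₂ _+_ (∑-𝟙-≟ p) (∑-𝟙-≟ q)) ⟩
      d + d + 2
        ≡⟨ solve 1 (λ d → d :+ d :+ con 2 := con 1 :+ con 2 :* d :+ con 1) refl d ⟩
      suc (2 * d) + 1 ∎
      where
      open +-*-Solver
      N-sum : ∀ x → ∑[ y < n ] N x y ≡ d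
      N-sum x = trans (sym (degree≡∑ G x)) (regular x)
    slots-sum : ∑[ y < n ] (1 + E v y) ≡ n + 1
    slots-sum = begin
      ∑[ y < n ] (1 + E v y)         ≡⟨ ∑-distrib-+ (λ _ → 1) (E v) ⟩
      ∑[ y < n ] 1 + ∑[ y < n ] E v y ≡⟨ cong₂ _+_ (trans (∑-const n 1) (*-identityʳ n)) (∑-𝟙-≟ v) ⟩
      n + 1                           ∎

maxDegree : ℕ → ℕ
maxDegree n = (n ∸ 1) / 4 + n / 4

[r+q*4]/4≡q : ∀ {r} q → r < 4 → (r + q * 4) / 4 ≡ q
[r+q*4]/4≡q {r} q r<4 =
  trans (+-distrib-/-∣ʳ r (divides-refl q)) (cong₂ _+_ (m<n⇒m/n≡0 r<4) (m*n/n≡m q 4))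

q+q≡2q : ∀ q → q + q ≡ 2 * q
q+q≡2q q = cong (q +_) (sym (+-identityʳ q))

2d<2[x+1]⇒d≤x : ∀ {d x} → 2 * d < 2 * suc x → d ≤ x
2d<2[x+1]⇒d≤x {d} {x} 2d<2x+2 = s≤s⁻¹ (*-cancelˡ-< 2 d (suc x) 2d<2x+2)

¬2∣odd : ∀ x → ¬ 2 ∣ suc (2 * x)
¬2∣odd x 2∣odd =
  contradiction (∣1⇒≡1 (∣m+n∣m⇒∣n (subst (2 ∣_) (+-comm 1 (2 * x)) 2∣odd) (m∣m*n x))) λ ()

maxDegree-4q+4 : ∀ q → maxDegree (suc q * 4) ≡ suc (2 * q)
maxDegree-4q+4 q = begin
  (3 + q * 4) / 4 + (suc q * 4) / 4
    ≡⟨ cong₂ _+_ ([r+q*4]/4≡q q (n<1+n 3)) ([r+q*4]/4≡q (suc q) (s≤s z≤n)) ⟩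
  q + suc q
    ≡⟨ trans (+-suc q q) (cong suc (q+q≡2q q)) ⟩
  suc (2 * q) ∎
  where open ≡-Reasoning

maxDegree-4q+r : ∀ {r} q → suc r < 4 → maxDegree (suc r + q * 4) ≡ 2 * q
maxDegree-4q+r q r+1<4 =
  trans (cong₂ _+_ ([r+q*4]/4≡q q (<-trans (n<1+n _) r+1<4)) ([r+q*4]/4≡q q r+1<4)) (q+q≡2q q)

2[2q+1]≡4q+2 : ∀ q → 2 * suc (2 * q) ≡ 2 + q * 4
2[2q+1]≡4q+2 = solve 1 (λ q → con 2 :* (con 1 :+ con 2 :* q) := con 2 :+ q :* con 4) refl
  where open +-*-Solver

2[2q+2]≡4q+4 : ∀ q → 2 * suc (suc (2 * q)) ≡ suc q * 4
2[2q+2]≡4q+4 = solve 1 (λ q → con 2 :* (con 2 :+ con 2 :* q) := (con 1 :+ q) :* con 4) refl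
  where open +-*-Solver

degree-bound : ∀ n d → 2 * d < n → 2 ∣ n * d → d ≤ maxDegree n
degree-bound n d 2d<n 2∣nd with n divMod 4
... | result zero    zero                   refl = contradiction 2d<n λ ()
... | result (suc q) zero                   refl =
  subst (d ≤_) (sym (maxDegree-4q+4 q)) (2d<2[x+1]⇒d≤x (subst (2 * d <_) (sym (2[2q+2]≡4q+4 q)) 2d<n))
... | result q       (suc zero)             refl =
  subst (d ≤_) (sym (maxDegree-4q+r q (s≤s (s≤s z≤n))))
    (2d<2[x+1]⇒d≤x (subst (2 * d <_) (sym (2[2q+1]≡4q+2 q)) (<-trans 2d<n (n<1+n _))))
... | result q       (suc (suc zero))       refl =
  subst (d ≤_) (sym (maxDegree-4q+r q (s≤s (s≤s (s≤s z≤n)))))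
    (2d<2[x+1]⇒d≤x (subst (2 * d <_) (sym (2[2q+1]≡4q+2 q)) 2d<n))
... | result q       (suc (suc (suc zero))) refl
  with m≤n⇒m<n∨m≡n (2d<2[x+1]⇒d≤x (subst (2 * d <_) (sym (2[2q+2]≡4q+4 q)) (<-trans 2d<n (n<1+n _))))
...   | inj₁ d<2q+1 = subst (d ≤_) (sym (maxDegree-4q+r q (n<1+n 3))) (s≤s⁻¹ d<2q+1)
...   | inj₂ refl with euclidsLemma (3 + q * 4) (suc (2 * q)) prime[2] 2∣nd
...     | inj₁ 2∣n = ⊥-elim (¬2∣odd (suc (2 * q)) (subst (2 ∣_) (cong suc (sym (2[2q+1]≡4q+2 q))) 2∣n))
...     | inj₂ 2∣d = ⊥-elim (¬2∣odd q 2∣d)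

-- The critical pair at 0 is obtained only up to double negation, which the decidable goal absorbs.
upper-bound : ∀ {m} d (G : Graph (suc m)) → Regular d G → DistanceCritical G → d ≤ maxDegree (suc m)
upper-bound {m} d G regular distanceCritical = decidable-stable (d ≤? maxDegree (suc m))
  (¬¬-map (λ c → degree-bound (suc m) d (criticalPair⇒2d<n c regular) (handshake G regular))
          (distanceCriticalAt⇒¬¬criticalPair {G = G} {v = zero} (distanceCritical zero)))

-- Isomorphisms and rotations

record _≅_ {n} (G H : Graph n) : Set where
  field
    bijection     : Permutation′ n
    preserves-adj : ∀ x y → adj H (bijection ⟨$⟩ʳ x) (bijection ⟨$⟩ʳ y) ≡ adj G x y
open _≅_

≅-refl : ∀ {n} {G : Graph n} → G ≅ G
≅-refl = record { bijection = Perm.id ; preserves-adj = λ _ _ → refl }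

≅-trans : ∀ {n} {G H K : Graph n} → G ≅ H → H ≅ K → G ≅ K
≅-trans f g = record
  { bijection     = bijection f ∘ₚ bijection g
  ; preserves-adj = λ x y → trans (preserves-adj g _ _) (preserves-adj f x y)
  }

module _ {n} {G H : Graph n} (f : G ≅ H) where
  private
    π = bijection f

  ≅-walk : ∀ {x y L} → Walk G x y L → Walk H (π ⟨$⟩ʳ x) (π ⟨$⟩ʳ y) L
  ≅-walk here           = here
  ≅-walk (step x~z w) = step (trans (preserves-adj f _ _) x~z) (≅-walk w)

  ≅-degree : ∀ x → degree H (π ⟨$⟩ʳ x) ≡ degree G x
  ≅-degree x = begin
    degree H (π ⟨$⟩ʳ x)                       ≡⟨ degree≡∑ H (π ⟨$⟩ʳ x) ⟩
    ∑[ y < n ] 𝟙 (adj H (π ⟨$⟩ʳ x) y)          ≡⟨ ∑-permute (𝟙 ∘ adj H (π ⟨$⟩ʳ x)) π ⟩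
    ∑[ y < n ] 𝟙 (adj H (π ⟨$⟩ʳ x) (π ⟨$⟩ʳ y)) ≡⟨ sum-cong-≗ (cong 𝟙 ∘ preserves-adj f x) ⟩
    ∑[ y < n ] 𝟙 (adj G x y)                  ≡⟨ degree≡∑ G x ⟨
    degree G x                                ∎
    where open ≡-Reasoning

  ≅-criticalPair : ∀ {v} → CriticalPair G v → CriticalPair H (π ⟨$⟩ʳ v)
  ≅-criticalPair {v} c = record
    { p               = π ⟨$⟩ʳ p
    ; q               = π ⟨$⟩ʳ q
    ; v~p             = trans (preserves-adj f v p) v~p
    ; v~q             = trans (preserves-adj f v q) v~q
    ; p≢q             = p≢q ∘ Injection.injective (↔⇒↣ π)
    ; p≁q             = trans (preserves-adj f p q) p≁q
    ; midpoint-unique = λ u πp~u u~πq → trans (sym (Perm.inverseʳ π)) (cong (π ⟨$⟩ʳ_)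
        (midpoint-unique (π ⟨$⟩ˡ u) (trans (adj-from p u) πp~u)
          (trans (adj-sym G _ q) (trans (adj-from q u) (trans (adj-sym H _ u) u~πq)))))
    }
    where
    open CriticalPair c
    adj-from : ∀ x u → adj G x (π ⟨$⟩ˡ u) ≡ adj H (π ⟨$⟩ʳ x) u
    adj-from x u = trans (sym (preserves-adj f x (π ⟨$⟩ˡ u))) (cong (adj H (π ⟨$⟩ʳ x)) (Perm.inverseʳ π))

≅-deleteVertex : ∀ {m} {G H : Graph (suc m)} (f : G ≅ H) v →
  deleteVertex G v ≅ deleteVertex H (bijection f ⟨$⟩ʳ v)
≅-deleteVertex {H = H} f v = record
  { bijection     = Perm.remove v π
  ; preserves-adj = λ i j → trans
      (cong₂ (adj H) (sym (Perm.punchIn-permute π v i)) (sym (Perm.punchIn-permute π v j)))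
      (preserves-adj f (punchIn v i) (punchIn v j))
  }
  where
  π = bijection f

module _ {m} {G : Graph (suc m)} (w : Fin (suc m))
         (transitive : ∀ v → ∃ λ (f : G ≅ G) → bijection f ⟨$⟩ʳ w ≡ v) where

  transitive⇒regular : Regular (degree G w) G
  transitive⇒regular v with transitive v
  ... | f , f[w]≡v = subst (λ u → degree G u ≡ degree G w) f[w]≡v (≅-degree f w)

  transitive⇒distanceCritical : (c : CriticalPair G w) → ∀ {i j L} →
    punchIn w i ≡ CriticalPair.p c → punchIn w j ≡ CriticalPair.q c →
    Walk (deleteVertex G w) i j L → DistanceCritical G
  transitive⇒distanceCritical c {i} {j} i↦p j↦q walk v with transitive v
  ... | f , f[w]≡v = subst (DistanceCriticalAt G) f[w]≡v
    (criticalPair⇒distanceCriticalAt (≅-criticalPair f c) (moved i↦p) (moved j↦q)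
                                     (≅-walk (≅-deleteVertex f w) walk))
    where
    π = bijection f
    moved : ∀ {k x} → punchIn w k ≡ x → punchIn (π ⟨$⟩ʳ w) (Perm.remove w π ⟨$⟩ʳ k) ≡ π ⟨$⟩ʳ x
    moved {k} k↦x = trans (sym (Perm.punchIn-permute π w k)) (cong (π ⟨$⟩ʳ_) k↦x)

-- i ↦ i + 1 (mod m + 1)
rotate : ∀ {m} → Permutation′ (suc m)
rotate {m} = Perm.insert (fromℕ m) zero Perm.id

punchIn-fromℕ : ∀ {m} (i : Fin m) → punchIn (fromℕ m) i ≡ inject₁ i
punchIn-fromℕ zero    = refl
punchIn-fromℕ (suc i) = cong suc (punchIn-fromℕ i)

rotate-inject₁ : ∀ {m} (i : Fin m) → rotate ⟨$⟩ʳ inject₁ i ≡ suc i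
rotate-inject₁ {m} i =
  trans (cong (rotate ⟨$⟩ʳ_) (sym (punchIn-fromℕ i))) (Perm.insert-punchIn (fromℕ m) zero Perm.id i)

rotate-fromℕ : ∀ m → rotate ⟨$⟩ʳ fromℕ m ≡ zero
rotate-fromℕ m = Perm.inverseʳ (rotate {m})

toℕ-rotate : ∀ {m} (x : Fin (suc m)) → toℕ x < m → toℕ (rotate ⟨$⟩ʳ x) ≡ suc (toℕ x)
toℕ-rotate {m} x x<m with view x
... | ‵fromℕ     = contradiction x<m (<-irrefl (Fin.toℕ-fromℕ m))
... | ‵inject₁ i = trans (cong toℕ (rotate-inject₁ i)) (cong suc (sym (Fin.toℕ-inject₁ i)))

rotate-≢ : ∀ {m} (x : Fin (suc (suc m))) → rotate ⟨$⟩ʳ x ≢ x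
rotate-≢ x with view x
... | ‵fromℕ     = λ ρx≡x → contradiction (trans (sym (rotate-fromℕ _)) ρx≡x) λ ()
... | ‵inject₁ i = λ ρx≡x →
  1+n≢n (trans (cong toℕ (trans (sym (rotate-inject₁ i)) ρx≡x)) (Fin.toℕ-inject₁ i))

-- Circulant graphs

module Circulant (m k : ℕ) where

  -- For d ≤ m, near d says that the cyclic distance min(d, m + 1 ∸ d) lies between 1 and k.
  near : ℕ → Bool
  near zero    = false
  near (suc d) = does (d <? k) ∨ does (m ≤? d + k)

  circulant : Graph (suc m)
  circulant = record
    { adj    = λ x y → near ∣ toℕ x - toℕ y ∣
    ; sym    = λ x y → cong near (∣-∣-comm (toℕ x) (toℕ y))
    ; irrefl = λ x → cong near (∣n-n∣≡0 (toℕ x))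
    }

  near⇒ : ∀ d → near d ≡ true → d ≤ k ⊎ m < d + k
  near⇒ (suc d) near-d = Sum.map₂ s≤s (does-∨⇒⊎ (d <? k) (m ≤? d + k) near-d)

  near-short : ∀ {d} → d < k → near (suc d) ≡ true
  near-short {d} d<k = cong (_∨ does (m ≤? d + k)) (dec-true (d <? k) d<k)

  near-long : ∀ {d} → m ≤ d + k → near (suc d) ≡ true
  near-long {d} m≤d+k =
    trans (cong (does (d <? k) ∨_) (dec-true (m ≤? d + k) m≤d+k)) (∨-zeroʳ (does (d <? k)))

  near-mirror : ∀ a c → suc (a + c) ≡ m → near (suc a) ≡ near (suc c)
  near-mirror a c a+c+1≡m = trans
    (cong₂ _∨_ (does-⇔ (a<k⇔m≤c+k a+c+1≡m) (a <? k) (m ≤? c + k))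
               (sym (does-⇔ (a<k⇔m≤c+k c+a+1≡m) (c <? k) (m ≤? a + k))))
    (∨-comm (does (m ≤? c + k)) (does (c <? k)))
    where
    c+a+1≡m = trans (cong suc (+-comm c a)) a+c+1≡m

  near-wrap : ∀ (i : Fin m) → near ∣ toℕ i - m ∣ ≡ near (suc (toℕ i))
  near-wrap i = begin
    near ∣ a - m ∣         ≡⟨ cong (λ t → near ∣ a - t ∣) (trans (+-suc a c) a+c+1≡m) ⟨
    near ∣ a - a + suc c ∣ ≡⟨ cong near (∣m-m+n∣≡n a (suc c)) ⟩
    near (suc c)           ≡⟨ near-mirror a c a+c+1≡m ⟨
    near (suc a)           ∎
    where
    open ≡-Reasoning
    a = toℕ i
    c = m ∸ suc a
    a+c+1≡m : suc (a + c) ≡ m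
    a+c+1≡m = m+[n∸m]≡n (Fin.toℕ<n i)

  rotate-preserves : ∀ x y → adj circulant (rotate ⟨$⟩ʳ x) (rotate ⟨$⟩ʳ y) ≡ adj circulant x y
  rotate-preserves x y with view x | view y
  ... | ‵fromℕ     | ‵fromℕ     rewrite rotate-fromℕ m = sym (irrefl circulant (fromℕ m))
  ... | ‵inject₁ i | ‵inject₁ j rewrite rotate-inject₁ i | rotate-inject₁ j
                                      | Fin.toℕ-inject₁ i | Fin.toℕ-inject₁ j = refl
  ... | ‵inject₁ i | ‵fromℕ     rewrite rotate-inject₁ i | rotate-fromℕ m
                                      | Fin.toℕ-inject₁ i | Fin.toℕ-fromℕ m = sym (near-wrap i)
  ... | ‵fromℕ     | ‵inject₁ j rewrite rotate-inject₁ j | rotate-fromℕ m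
                                      | Fin.toℕ-inject₁ j | Fin.toℕ-fromℕ m =
    trans (sym (near-wrap j)) (cong near (∣-∣-comm (toℕ j) m))

  rotation^ : ℕ → circulant ≅ circulant
  rotation^ zero    = ≅-refl
  rotation^ (suc a) = ≅-trans (rotation^ a) record { bijection = rotate ; preserves-adj = rotate-preserves }

  toℕ-rotation^ : ∀ a → a ≤ m → toℕ (bijection (rotation^ a) ⟨$⟩ʳ zero) ≡ a
  toℕ-rotation^ zero    _   = refl
  toℕ-rotation^ (suc a) a<m = trans (toℕ-rotate _ (subst (_< m) (sym ih) a<m)) (cong suc ih)
    where
    ih = toℕ-rotation^ a (<⇒≤ a<m)

  vertex-transitive : ∀ v → ∃ λ (f : circulant ≅ circulant) → bijection f ⟨$⟩ʳ zero ≡ v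
  vertex-transitive v =
    rotation^ (toℕ v) , Fin.toℕ-injective (toℕ-rotation^ (toℕ v) (s≤s⁻¹ (Fin.toℕ<n v)))

  degree-zero : 2 * k ≤ m → degree circulant zero ≡ 2 * k
  degree-zero 2k≤m = begin
    degree circulant zero
      ≡⟨ degree≡∑ circulant zero ⟩
    ∑[ y < m ] 𝟙 (does (toℕ y <? k) ∨ does (m ≤? toℕ y + k))
      ≡⟨ sum-cong-≗ {m} (λ y → 𝟙-∨-disjoint short⇒¬long (toℕ y <? k) (m ≤? toℕ y + k)) ⟩
    ∑[ y < m ] (𝟙 (does (toℕ y <? k)) + 𝟙 (does (m ≤? toℕ y + k)))
      ≡⟨ ∑-distrib-+ {m} (λ y → 𝟙 (does (toℕ y <? k))) (λ y → 𝟙 (does (m ≤? toℕ y + k))) ⟩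
    ∑[ y < m ] 𝟙 (does (toℕ y <? k)) + ∑[ y < m ] 𝟙 (does (m ≤? toℕ y + k))
      ≡⟨ cong₂ _+_ (∑-𝟙-i<k k≤m) (∑-𝟙-n≤i+k k≤m) ⟩
    k + k
      ≡⟨ q+q≡2q k ⟩
    2 * k ∎
    where
    open ≡-Reasoning
    k≤m = ≤-trans (m≤m+n k (k + 0)) 2k≤m
    short⇒¬long : ∀ {y} → y < k → ¬ m ≤ y + k
    short⇒¬long {y} y<k m≤y+k =
      <⇒≱ (subst (y + k <_) (q+q≡2q k) (+-monoˡ-< k y<k)) (≤-trans 2k≤m m≤y+k)

  regular : 2 * k ≤ m → Regular (2 * k) circulant
  regular 2k≤m v = trans (transitive⇒regular zero vertex-transitive v) (degree-zero 2k≤m)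

module CirculantCriticality (m k₀ : ℕ) (4k≤m : 4 * suc k₀ ≤ m) where
  open Circulant m (suc k₀)

  private
    k c : ℕ
    k = suc k₀
    c = m ∸ k

    c+k≡m : c + k ≡ m
    c+k≡m = m∸n+n≡m (≤-trans (m≤m+n k (3 * k)) 4k≤m)

    3k≤c : 3 * k ≤ c
    3k≤c = +-cancelʳ-≤ k (3 * k) c (subst₂ _≤_ (+-comm k (3 * k)) (sym c+k≡m) 4k≤m)

    k≤c : k ≤ c
    k≤c = ≤-trans (m≤m+n k (2 * k)) 3k≤c

    2k≤c : 2 * k ≤ c
    2k≤c = ≤-trans (m≤n+m (2 * k) k) 3k≤c

    c<m : c < m
    c<m = subst (c <_) c+k≡m (m<m+n c (s≤s z≤n))

    -- In G − 0 the critical pair k, m + 1 ∸ k at 0 becomes i, j, joined by the path i, i + 1, …, j.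
    i j : Fin m
    i = fromℕ< (≤-<-trans (n≤1+n k₀) (≤-<-trans k≤c c<m))
    j = fromℕ< c<m

    toℕ-p : toℕ (suc i) ≡ k
    toℕ-p = cong suc (Fin.toℕ-fromℕ< _)

    toℕ-q : toℕ (suc j) ≡ suc c
    toℕ-q = cong suc (Fin.toℕ-fromℕ< c<m)

  near-ordered⇒ : ∀ {a b} → a ≤ b → near ∣ a - b ∣ ≡ true → b ≤ a + k ⊎ m < (b ∸ a) + k
  near-ordered⇒ {a} {b} a≤b near-ab
    with near⇒ (b ∸ a) (subst (λ d → near d ≡ true) (m≤n⇒∣m-n∣≡n∸m a≤b) near-ab)
  ... | inj₁ b-a≤k = inj₁ (subst (_≤ a + k) (m+[n∸m]≡n a≤b) (+-monoʳ-≤ a b-a≤k))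
  ... | inj₂ m<b-a+k = inj₂ m<b-a+k

  near-p⇒≤2k : ∀ x → x ≤ m → near ∣ k - x ∣ ≡ true → x ≤ 2 * k
  near-p⇒≤2k x x≤m near-kx with x ≤? k
  ... | yes x≤k = ≤-trans x≤k (m≤m+n k (k + 0))
  ... | no x≰k with near-ordered⇒ (<⇒≤ (≰⇒> x≰k)) near-kx
  ...   | inj₁ x≤k+k     = ≤-trans x≤k+k (≤-reflexive (q+q≡2q k))
  ...   | inj₂ m<x-k+k = contradiction (subst (m <_) (m∸n+n≡m (<⇒≤ (≰⇒> x≰k))) m<x-k+k) (≤⇒≯ x≤m)

  near-q⇒≡0 : ∀ x → x ≤ 2 * k → near ∣ x - suc c ∣ ≡ true → x ≡ 0
  near-q⇒≡0 x x≤2k near-xq = Sum.[ too-close , wraps-around ] (near-ordered⇒ x≤c+1 near-xq)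
    where
    x≤c+1 : x ≤ suc c
    x≤c+1 = ≤-trans x≤2k (≤-trans 2k≤c (n≤1+n c))
    too-close : suc c ≤ x + k → x ≡ 0
    too-close c+1≤x+k = contradiction (≤-trans c+1≤x+k (≤-trans (+-monoˡ-≤ k x≤2k) 3k≤c′)) 1+n≰n
      where
      3k≤c′ = ≤-trans (≤-reflexive (+-comm (2 * k) k)) 3k≤c
    wraps-around : m < (suc c ∸ x) + k → x ≡ 0
    wraps-around m<c+1-x+k = n≤0⇒n≡0 (+-cancelʳ-≤ (suc m) x 0 (begin
      x + suc m             ≤⟨ +-monoʳ-≤ x m<c+1-x+k ⟩
      x + ((suc c ∸ x) + k) ≡⟨ +-assoc x (suc c ∸ x) k ⟨
      x + (suc c ∸ x) + k   ≡⟨ cong (_+ k) (m+[n∸m]≡n x≤c+1) ⟩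
      suc c + k             ≡⟨ cong suc c+k≡m ⟩
      suc m                 ∎))
      where open ≤-Reasoning

  ¬near-pq : ¬ near ∣ k - suc c ∣ ≡ true
  ¬near-pq near-pq = Sum.[ too-close , wraps-around ] (near-ordered⇒ k≤c+1 near-pq)
    where
    k≤c+1 = ≤-trans k≤c (n≤1+n c)
    too-close : suc c ≤ k + k → ⊥
    too-close c+1≤k+k = 1+n≰n (≤-trans c+1≤k+k (≤-trans (≤-reflexive (q+q≡2q k)) 2k≤c))
    wraps-around : m < (suc c ∸ k) + k → ⊥
    wraps-around m<c+1-k+k = <⇒≱ c<m (s≤s⁻¹ (subst (m <_) (m∸n+n≡m k≤c+1) m<c+1-k+k))

  criticalPair : CriticalPair circulant zero
  criticalPair = record
    { p               = suc i
    ; q               = suc j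
    ; v~p             = trans (cong near toℕ-p) (near-short ≤-refl)
    ; v~q             = trans (cong near toℕ-q) (near-long (≤-reflexive (sym c+k≡m)))
    ; p≢q             = λ p≡q → <⇒≢ (s≤s k≤c) (trans (sym toℕ-p) (trans (cong toℕ p≡q) toℕ-q))
    ; p≁q             = trans (cong₂ (λ a b → near ∣ a - b ∣) toℕ-p toℕ-q) (¬-not ¬near-pq)
    ; midpoint-unique = λ u p~u u~q → Fin.toℕ-injective (near-q⇒≡0 (toℕ u)
        (near-p⇒≤2k (toℕ u) (s≤s⁻¹ (Fin.toℕ<n u)) (subst (λ a → near ∣ a - toℕ u ∣ ≡ true) toℕ-p p~u))
        (subst (λ b → near ∣ toℕ u - b ∣ ≡ true) toℕ-q u~q))
    }

  walk-avoiding-0 : Walk (deleteVertex circulant zero) i j (c ∸ k₀)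
  walk-avoiding-0 = ascending-walk (deleteVertex circulant zero) consecutive (c ∸ k₀) i+[c-k₀]≡j
    where
    i+[c-k₀]≡j : toℕ i + (c ∸ k₀) ≡ toℕ j
    i+[c-k₀]≡j = trans (cong (_+ (c ∸ k₀)) (Fin.toℕ-fromℕ< _))
                       (trans (m+[n∸m]≡n (≤-trans (n≤1+n k₀) k≤c)) (sym (Fin.toℕ-fromℕ< c<m)))
    consecutive : ∀ a b → toℕ b ≡ suc (toℕ a) → Edge (deleteVertex circulant zero) a b
    consecutive a b b≡a+1 = trans (cong (λ t → near ∣ toℕ a - t ∣) (trans b≡a+1 (+-comm 1 (toℕ a))))
                                  (trans (cong near (∣m-m+n∣≡n (toℕ a) 1)) (near-short (s≤s z≤n)))

  distanceCritical : DistanceCritical circulant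
  distanceCritical =
    transitive⇒distanceCritical zero vertex-transitive criticalPair refl refl walk-avoiding-0

-- The four-block graph

module FourBlocks {k} (σ : Permutation′ (suc k)) (σ-≢ : ∀ a → σ ⟨$⟩ʳ a ≢ a) where

  pattern A = zero
  pattern B = suc zero
  pattern C = suc (suc zero)
  pattern D = suc (suc (suc zero))

  private
    K = suc k

    σʳ σˡ : Fin K → Fin K
    σʳ a = σ ⟨$⟩ʳ a
    σˡ a = σ ⟨$⟩ˡ a

    _==_ : Fin K → Fin K → Bool
    a == b = does (a Fin.≟ b)

    ==-refl : ∀ a → a == a ≡ true
    ==-refl a = dec-true (a Fin.≟ a) refl

    ==-sym : ∀ a b → a == b ≡ b == a
    ==-sym a b = does-⇔ (mk⇔ sym sym) (a Fin.≟ b) (b Fin.≟ a)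

    ==⇒≡ : ∀ a b → a == b ≡ true → a ≡ b
    ==⇒≡ a b = does⇒ (a Fin.≟ b)

    ≢⇒/== : ∀ {a b} → a ≢ b → not (a == b) ≡ true
    ≢⇒/== {a} {b} a≢b = cong not (dec-false (a Fin.≟ b) a≢b)

    /==⇒≢ : ∀ a b → not (a == b) ≡ true → a ≢ b
    /==⇒≢ a _ a/=b refl = contradiction (trans (sym a/=b) (cong not (==-refl a))) λ ()

  link : Fin 4 → Fin K → Fin 4 → Fin K → Bool
  link A a A b = not (a == b)
  link A a C b = a == b
  link A a D b = not (σʳ a == b)
  link B a B b = not (a == b)
  link B a C b = not (a == b)
  link B a D b = a == b
  link C a A b = a == b
  link C a B b = not (a == b)
  link C a C b = not (a == b)
  link D a A b = not (a == σʳ b)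
  link D a B b = a == b
  link D a D b = not (a == b)
  link _ _ _ _ = false

  link-sym : ∀ X a Y b → link X a Y b ≡ link Y b X a
  link-sym A a A b = cong not (==-sym a b)
  link-sym A a B b = refl
  link-sym A a C b = ==-sym a b
  link-sym A a D b = cong not (==-sym (σʳ a) b)
  link-sym B a A b = refl
  link-sym B a B b = cong not (==-sym a b)
  link-sym B a C b = cong not (==-sym a b)
  link-sym B a D b = ==-sym a b
  link-sym C a A b = ==-sym a b
  link-sym C a B b = cong not (==-sym a b)
  link-sym C a C b = cong not (==-sym a b)
  link-sym C a D b = refl
  link-sym D a A b = cong not (==-sym a (σʳ b))
  link-sym D a B b = ==-sym a b
  link-sym D a C b = refl
  link-sym D a D b = cong not (==-sym a b)

  link-irrefl : ∀ X a → link X a X a ≡ false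
  link-irrefl A a = cong not (==-refl a)
  link-irrefl B a = cong not (==-refl a)
  link-irrefl C a = cong not (==-refl a)
  link-irrefl D a = cong not (==-refl a)

  vertex : Fin 4 → Fin K → Fin (K * 4)
  vertex X a = Fin.combine a X

  block : Fin (K * 4) → Fin 4
  block x = proj₂ (Fin.remQuot {K} 4 x)

  index : Fin (K * 4) → Fin K
  index x = proj₁ (Fin.remQuot {K} 4 x)

  vertex-block-index : ∀ x → vertex (block x) (index x) ≡ x
  vertex-block-index = Fin.combine-remQuot {K} 4

  blocks : Graph (K * 4)
  blocks = record
    { adj    = λ x y → link (block x) (index x) (block y) (index y)
    ; sym    = λ x y → link-sym (block x) (index x) (block y) (index y)
    ; irrefl = λ x → link-irrefl (block x) (index x)
    }

  adj-vertex : ∀ X a Y b → adj blocks (vertex X a) (vertex Y b) ≡ link X a Y b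
  adj-vertex X a Y b = cong₂ (λ (x y : Fin K × Fin 4) → link (proj₂ x) (proj₁ x) (proj₂ y) (proj₁ y))
                             (Fin.remQuot-combine a X) (Fin.remQuot-combine b Y)

  degree-vertex : ∀ X a → degree blocks (vertex X a) ≡ ∑[ Y < 4 ] ∑[ b < K ] 𝟙 (link X a Y b)
  degree-vertex X a = begin
    degree blocks (vertex X a)
      ≡⟨ degree≡∑ blocks (vertex X a) ⟩
    ∑[ y < K * 4 ] 𝟙 (adj blocks (vertex X a) y)
      ≡⟨ ∑-combine {K} {4} (𝟙 ∘ adj blocks (vertex X a)) ⟩
    ∑[ b < K ] ∑[ Y < 4 ] 𝟙 (adj blocks (vertex X a) (vertex Y b))
      ≡⟨ sum-cong-≗ {K} (λ b → sum-cong-≗ {4} (λ Y → cong 𝟙 (adj-vertex X a Y b))) ⟩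
    ∑[ b < K ] ∑[ Y < 4 ] 𝟙 (link X a Y b)
      ≡⟨ ∑-comm {K} {4} (λ b Y → 𝟙 (link X a Y b)) ⟩
    ∑[ Y < 4 ] ∑[ b < K ] 𝟙 (link X a Y b) ∎
    where open ≡-Reasoning

  private
    row : ∀ {s₁ s₂ s₃ s₄ n₁ n₂ n₃ n₄ : ℕ} → s₁ ≡ n₁ → s₂ ≡ n₂ → s₃ ≡ n₃ → s₄ ≡ n₄ →
      s₁ + (s₂ + (s₃ + (s₄ + 0))) ≡ n₁ + (n₂ + (n₃ + (n₄ + 0)))
    row e₁ e₂ e₃ e₄ = cong₂ _+_ e₁ (cong₂ _+_ e₂ (cong₂ _+_ e₃ (cong (_+ 0) e₄)))

    none : ∑[ b < K ] 𝟙 false ≡ 0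
    none = sum-replicate-zero K

    all-but-σ : ∀ a → ∑[ b < K ] 𝟙 (not (a == σʳ b)) ≡ k
    all-but-σ a = trans (sym (∑-permute (λ b → 𝟙 (not (a == b))) σ)) (∑-𝟙-≢ a)

  row-count : ∀ X a → ∑[ Y < 4 ] ∑[ b < K ] 𝟙 (link X a Y b) ≡ suc (2 * k)
  row-count A a = trans (row (∑-𝟙-≢ a) none (∑-𝟙-≟ a) (∑-𝟙-≢ (σʳ a))) (+-suc k (k + 0))
  row-count B a = trans (row none (∑-𝟙-≢ a) (∑-𝟙-≢ a) (∑-𝟙-≟ a))
                        (trans (cong (k +_) (+-suc k 0)) (+-suc k (k + 0)))
  row-count C a = row (∑-𝟙-≟ a) (∑-𝟙-≢ a) (∑-𝟙-≢ a) none
  row-count D a = trans (row (all-but-σ a) (∑-𝟙-≟ a) none (∑-𝟙-≢ a)) (+-suc k (k + 0))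

  regular : Regular (suc (2 * k)) blocks
  regular x = subst (λ x → degree blocks x ≡ suc (2 * k)) (vertex-block-index x)
    (trans (degree-vertex (block x) (index x)) (row-count (block x) (index x)))

  private
    edge : ∀ X a Y b → link X a Y b ≡ true → Edge blocks (vertex X a) (vertex Y b)
    edge X a Y b = trans (adj-vertex X a Y b)

    vertex-≢ : ∀ X a Y b → X ≢ Y → vertex X a ≢ vertex Y b
    vertex-≢ X a Y b X≢Y = X≢Y ∘ Fin.combine-injectiveʳ a X b Y

    σˡ-≢ : ∀ b → σˡ b ≢ b
    σˡ-≢ b σˡb≡b = σ-≢ b (trans (cong σʳ (sym σˡb≡b)) (Perm.inverseʳ σ))

  blockPair : ∀ X a P p Q q → P ≢ Q → link X a P p ≡ true → link X a Q q ≡ true → link P p Q q ≡ false →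
    (∀ Y b → link P p Y b ≡ true → link Y b Q q ≡ true → vertex Y b ≡ vertex X a) →
    CriticalPair blocks (vertex X a)
  blockPair X a P p Q q P≢Q X~P X~Q P≁Q unique = record
    { p               = vertex P p
    ; q               = vertex Q q
    ; v~p             = edge X a P p X~P
    ; v~q             = edge X a Q q X~Q
    ; p≢q             = vertex-≢ P p Q q P≢Q
    ; p≁q             = trans (adj-vertex P p Q q) P≁Q
    ; midpoint-unique = λ u p~u u~q → trans (sym (vertex-block-index u)) (unique (block u) (index u)
        (trans (sym (adj-vertex P p (block u) (index u)))
               (subst (Edge blocks (vertex P p)) (sym (vertex-block-index u)) p~u))
        (trans (sym (adj-vertex (block u) (index u) Q q))
               (subst (λ x → Edge blocks x (vertex Q q)) (sym (vertex-block-index u)) u~q)))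
    }

  blockPath : ∀ X a (c : CriticalPair blocks (vertex X a)) M m M′ m′ → X ≢ M → X ≢ M′ →
    Edge blocks (CriticalPair.p c) (vertex M m) → link M m M′ m′ ≡ true →
    Edge blocks (vertex M′ m′) (CriticalPair.q c) → DistanceCriticalAt blocks (vertex X a)
  blockPath X a c M m M′ m′ X≢M X≢M′ p~x x~y y~q = criticalPair⇒distanceCriticalAt₃ c
    (vertex-≢ X a M m X≢M) (vertex-≢ X a M′ m′ X≢M′) p~x (edge M m M′ m′ x~y) y~q

  unique-A : ∀ a Y b → link C a Y b ≡ true → link Y b D a ≡ true → vertex Y b ≡ vertex A a
  unique-A a A b C~A _   = cong (vertex A) (sym (==⇒≡ a b C~A))
  unique-A a B b C~B B~D = contradiction (sym (==⇒≡ b a B~D)) (/==⇒≢ a b C~B)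
  unique-A a C b _   ()
  unique-A a D b ()  _

  unique-B : ∀ b Y x → link D b Y x ≡ true → link Y x C (σˡ b) ≡ true → vertex Y x ≡ vertex B b
  unique-B b A x D~A A~C =
    contradiction (sym (trans (cong σʳ (==⇒≡ x (σˡ b) A~C)) (Perm.inverseʳ σ))) (/==⇒≢ b (σʳ x) D~A)
  unique-B b B x D~B _   = cong (vertex B) (sym (==⇒≡ b x D~B))
  unique-B b C x ()  _
  unique-B b D x _   ()

  unique-C : ∀ c Y x → link A c Y x ≡ true → link Y x B (σʳ c) ≡ true → vertex Y x ≡ vertex C c
  unique-C c A x _   ()
  unique-C c B x ()  _
  unique-C c C x A~C _   = cong (vertex C) (sym (==⇒≡ c x A~C))
  unique-C c D x A~D D~B = contradiction (sym (==⇒≡ x (σʳ c) D~B)) (/==⇒≢ (σʳ c) x A~D)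

  unique-D : ∀ e Y x → link B e Y x ≡ true → link Y x A e ≡ true → vertex Y x ≡ vertex D e
  unique-D e A x ()  _
  unique-D e B x _   ()
  unique-D e C x B~C C~A = contradiction (sym (==⇒≡ x e C~A)) (/==⇒≢ e x B~C)
  unique-D e D x B~D _   = cong (vertex D) (sym (==⇒≡ e x B~D))

  distanceCriticalAt : ∀ X a → DistanceCriticalAt blocks (vertex X a)
  distanceCriticalAt A a = blockPath A a
    (blockPair A a C a D a (λ ()) (==-refl a) (≢⇒/== (σ-≢ a)) refl (unique-A a))
    B (σʳ a) D (σʳ a) (λ ()) (λ ())
    (edge C a B (σʳ a) (≢⇒/== (σ-≢ a ∘ sym))) (==-refl (σʳ a)) (edge D (σʳ a) D a (≢⇒/== (σ-≢ a)))
  distanceCriticalAt B b = blockPath B b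
    (blockPair B b D b C (σˡ b) (λ ()) (==-refl b) (≢⇒/== (σˡ-≢ b ∘ sym)) refl (unique-B b))
    D (σʳ b) A (σˡ b) (λ ()) (λ ())
    (edge D b D (σʳ b) (≢⇒/== (σ-≢ b ∘ sym)))
    (≢⇒/== (λ σb≡σσˡb → σ-≢ b (trans σb≡σσˡb (Perm.inverseʳ σ))))
    (edge A (σˡ b) C (σˡ b) (==-refl (σˡ b)))
  distanceCriticalAt C c = blockPath C c
    (blockPair C c A c B (σʳ c) (λ ()) (==-refl c) (≢⇒/== (σ-≢ c ∘ sym)) refl (unique-C c))
    D c D (σʳ c) (λ ()) (λ ())
    (edge A c D c (≢⇒/== (σ-≢ c))) (≢⇒/== (σ-≢ c ∘ sym)) (edge D (σʳ c) B (σʳ c) (==-refl (σʳ c)))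
  distanceCriticalAt D e = blockPath D e
    (blockPair D e B e A e (λ ()) (==-refl e) (≢⇒/== (σ-≢ e ∘ sym)) refl (unique-D e))
    C (σʳ e) A (σʳ e) (λ ()) (λ ())
    (edge B e C (σʳ e) (≢⇒/== (σ-≢ e ∘ sym))) (==-refl (σʳ e)) (edge A (σʳ e) A e (≢⇒/== (σ-≢ e)))

  distanceCritical : DistanceCritical blocks
  distanceCritical x =
    subst (DistanceCriticalAt blocks) (vertex-block-index x) (distanceCriticalAt (block x) (index x))

lower-bound : ∀ n → 5 ≤ n → ∃ λ (G : Graph n) → Regular (maxDegree n) G × DistanceCritical G
lower-bound n 5≤n with n divMod 4
... | result zero          zero    refl = contradiction 5≤n λ ()
... | result 1             zero    refl = contradiction (n<1+n 4) (≤⇒≯ 5≤n)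
... | result (suc (suc k)) zero    refl =
  blocks , subst (λ d → Regular d blocks) (sym (maxDegree-4q+4 (suc k))) regular , distanceCritical
  where open FourBlocks {suc k} rotate rotate-≢
... | result zero          (suc r) refl =
  contradiction (m<n⇒m<1+n (subst (_< 4) (sym (+-identityʳ _)) (Fin.toℕ<n (suc r)))) (≤⇒≯ 5≤n)
... | result (suc k)       (suc r) refl =
  circulant ,
  subst (λ d → Regular d circulant) (sym (maxDegree-4q+r (suc k) (Fin.toℕ<n (suc r)))) (regular 2k≤m) ,
  CirculantCriticality.distanceCritical m k 4k≤m
  where
  m = toℕ r + suc k * 4
  open Circulant m (suc k)
  4k≤m : 4 * suc k ≤ m
  4k≤m = ≤-trans (≤-reflexive (*-comm 4 (suc k))) (m≤n+m (suc k * 4) (toℕ r))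
  2k≤m : 2 * suc k ≤ m
  2k≤m = ≤-trans (*-monoˡ-≤ (suc k) (m≤m+n 2 2)) 4k≤m

lemma5p3 : ∀ n → 5 ≤ n →
    (∃ λ (G : Graph n) → Regular ((n ∸ 1) / 4 + n / 4) G × DistanceCritical G)
    × (∀ d (G : Graph n) → Regular d G → DistanceCritical G → d ≤ (n ∸ 1) / 4 + n / 4)
lemma5p3 (suc m) 5≤n = lower-bound (suc m) 5≤n , upper-bound
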